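{- Consider the stochastic unbounded min-knapsack problem described in the context, and assume every type $i$ is expensive, i.e. $c_i\ge\theta T$. Then the output $\hat V$ of Algorithm DP described in the context satisfies \[(1-\delta)\Big(1-\frac{\epsilon}{10}\Big)\hat V\le OPT_W\le \hat V.\]
   Context: Fix integers $n\ge1$, $W\ge1$ and $\epsilon\in(0,1)$. There are $n$ item types; type $i$ has a deterministic cost $c_i>0$ and a random weight $X_i$ with known distribution supported in $\{1,\dots,W\}$ (standing assumption: positive integer weights). Infinitely many items of each type, weights mutually independent; items are inserted one at a time, each weight revealed upon insertion, until the total weight is at least $W$; a strategy chooses adaptively which type to insert. Let $d_i(k)=\Pr[X_i=k]$. Set $OPT_w=0$ for integers $w\le0$ and $OPT_w=\min_{1\le j\le n}\big(c_j+\sum_{k=1}^{W}d_j(k)OPT_{w-k}\big)$ for $1\le w\le W$; $OPT_W$ is the minimum expected total cost. Let $\bar E[X_i]=\sum_{j=1}^W d_i(j)2^{\lfloor\log_2 j\rfloor}$, $T=\frac W2\min_i\frac{c_i}{\bar E[X_i]}$, $\theta=\frac{\epsilon}{10n}$, $\delta=\frac{\epsilon^2}{100n}$. Algorithm DP: set $f_0=0$. For $i=1,2,\dots,\lceil1/\delta\rceil+1$: given $f_0,\dots,f_{i-1}$, define for integers $w\ge1$: $g_w=j\delta T$ if $f_{j-1}<w\le f_j$ for some $1\le j\le i-1$, and $g_w=i\delta T$ if $w>f_{i-1}$; let $f_i=\max\{w'\in\{0,\dots,W\}:\exists k,\ c_k+\sum_{j=1}^{w'-1}d_k(w'-j)g_j\le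 i\delta T\}$ (with $f_i=0$ if no such $w'$ exists). If $f_i\ge W$, the algorithm outputs $\hat V=i\delta T$ and stops. -}

module Defs where

open import Data.Nat as ℕ using (ℕ; zero; suc; _∸_; _^_; _<ᵇ_; _≤ᵇ_; _≡ᵇ_)
open import Data.Nat.Logarithm using (⌊log₂_⌋)
open import Data.Integer using (+_; ∣_∣)
open import Data.Fin using (Fin; zero; suc)
open import Data.Bool using (Bool; true; false; if_then_else_; _∧_; _∨_)
open import Data.Maybe using (Maybe; just; nothing)
open import Data.Rational using (ℚ; 0ℚ; 1ℚ; _+_; _*_; _-_; _⊓_; _/_; 1/_; ≢-nonZero; ceiling)
open import Data.Rational.Properties using (_≟_; _≤?_)
open import Relation.Nullary using (yes; no)
open import Relation.Nullary.Decidable using (does)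

ℕ→ℚ : ℕ → ℚ
ℕ→ℚ k = + k / 1

-- division with the convention p ÷' 0 = 0 (only ever applied to nonzero divisors
-- under the theorem's hypotheses)
_÷'_ : ℚ → ℚ → ℚ
p ÷' q with q ≟ 0ℚ
... | yes _ = 0ℚ
... | no q≢0 = p * (1/_ q {{≢-nonZero q≢0}})

Σ₁ : ℕ → (ℕ → ℚ) → ℚ
Σ₁ zero    f = 0ℚ
Σ₁ (suc N) f = Σ₁ N f + f (suc N)

minFin : ∀ {m} → (Fin (suc m) → ℚ) → ℚ
minFin {zero}  f = f zero
minFin {suc m} f = f zero ⊓ minFin (λ i → f (suc i))

anyFin : ∀ {m} → (Fin (suc m) → Bool) → Bool
anyFin {zero}  f = f zero
anyFin {suc m} f = f zero ∨ anyFin (λ i → f (suc i))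

-- Problem data: n = suc m item types, target weight W, costs c, weight distributions
-- d i k = Pr[X_i = k]; accuracy parameter ε.
module Knapsack (m W : ℕ) (c : Fin (suc m) → ℚ) (d : Fin (suc m) → ℕ → ℚ) (ε : ℚ) where

  n : ℕ
  n = suc m

  -- one step of the OPT recursion: given f correct on 1..w-1, compute OPT_w
  -- (OPT_v = 0 for v ≤ 0 is encoded by the test k < w)
  optStep : (ℕ → ℚ) → ℕ → ℚ
  optStep f w = minFin (λ j → c j + Σ₁ W (λ k → d j k * (if k <ᵇ w then f (w ∸ k) else 0ℚ)))

  -- optTable w v = OPT_v for all v ≤ w
  optTable : ℕ → ℕ → ℚ
  optTable zero    v = 0ℚ
  optTable (suc w) v = if v ≤ᵇ w then optTable w v else optStep (optTable w) (suc w)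

  OPT : ℕ → ℚ
  OPT w = optTable w w

  Ebar : Fin (suc m) → ℚ
  Ebar i = Σ₁ W (λ j → d i j * ℕ→ℚ (2 ^ ⌊log₂ j ⌋))

  T : ℚ
  T = (ℕ→ℚ W * (+ 1 / 2)) * minFin (λ i → c i ÷' Ebar i)

  θ : ℚ
  θ = ε ÷' ℕ→ℚ (10 ℕ.* n)

  δ : ℚ
  δ = (ε * ε) ÷' ℕ→ℚ (100 ℕ.* n)

  lvl : ℕ → ℚ
  lvl i = ℕ→ℚ i * δ * T

  -- F j = f_j for j < i (the earlier thresholds).
  -- smallest j ∈ {1,…,i-1} with f_{j-1} < w ≤ f_j, if any
  findJ : (ℕ → ℕ) → ℕ → ℕ → ℕ → Maybe ℕ
  findJ F w j zero    = nothing
  findJ F w j (suc r) = if (F (j ∸ 1) <ᵇ w) ∧ (w ≤ᵇ F j) then just j else findJ F w (suc j) r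

  g : (ℕ → ℕ) → ℕ → ℕ → ℚ
  g F i w with findJ F w 1 (i ∸ 1)
  ... | just j  = lvl j
  ... | nothing = lvl i

  feasible : (ℕ → ℕ) → ℕ → ℕ → Bool
  feasible F i w' = anyFin (λ k → does (c k + Σ₁ (w' ∸ 1) (λ j → d k (w' ∸ j) * g F i j) ≤? lvl i))

  maxFeas : (ℕ → ℕ) → ℕ → ℕ → ℕ
  maxFeas F i zero    = 0
  maxFeas F i (suc v) = if feasible F i (suc v) then suc v else maxFeas F i v

  fNext : (ℕ → ℕ) → ℕ → ℕ
  fNext F i = maxFeas F i W

  loop : (ℕ → ℕ) → ℕ → ℕ → Maybe ℚ
  loop F i zero       = nothing
  loop F i (suc fuel) =
    if W ≤ᵇ fNext F i then just (lvl i)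
    else loop (λ j → if j ≡ᵇ i then fNext F i else F j) (suc i) fuel

  rounds : ℕ
  rounds = ∣ ceiling (1ℚ ÷' δ) ∣ ℕ.+ 1

  -- output of Algorithm DP (nothing if it never reaches f_i ≥ W)
  DP : Maybe ℚ
  DP = loop (λ _ → 0) 1 rounds

{-# OPTIONS --safe #-}
module Submission where

-- Since 2^⌊log₂ j⌋ ≥ j/2, induction on the recursion gives OPT_v ≥ (v/2)·min_i c_i/Ē[X_i];
-- in particular T ≤ OPT_W.
-- Round i settles the weights f_{i-1} < w ≤ f_i at level iδT, and g is the resulting
-- staircase. Two invariants survive every round, with μ = 1 - ε/10:
--  * OPT_w ≤ jδT for w settled in round j. If type k witnesses that w' = u+1 is
--    feasible, bound OPT_j by g_j on settled j and by x = OPT_{u+1} on pending j;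
--    the recursion becomes x ≤ s + p·x while feasibility reads s + p·iδT ≤ iδT, and
--    s ≥ c_k > 0 forces x ≤ iδT.
--  * μ(g_w - δT) ≤ OPT_w. For a weight beyond f_i every type costs more than iδT
--    against g; replacing g by OPT loses at most δT = (ε/10)·θT ≤ (ε/10)·c_k, which
--    is exactly the slack left by discounting with μ, as every type is expensive.
-- When f_i ≥ W the output V = iδT thus satisfies OPT_W ≤ V and μ(V - δT) ≤ OPT_W,
-- and δT ≤ δV because T ≤ OPT_W ≤ V.

open import Defs
open import Data.Nat using (ℕ; suc) renaming (_<_ to _<ℕ_; _≤_ to _≤ℕ_)
open import Data.Sum using (_⊎_)
open import Data.Product using (_×_)
open import Data.Fin using (Fin)
open import Data.Maybe using (just)
open import Data.Integer using (+_)
open import Relation.Binary.PropositionalEquality using (_≡_)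
open import Data.Rational using (ℚ; 0ℚ; 1ℚ; _*_; _-_; _/_; _≤_; _<_)

open import Level using (0ℓ)
open import Data.Bool using (Bool; true; false; if_then_else_; _∧_)
open import Data.Fin using (zero; suc)
open import Data.Maybe using (Maybe; nothing; _<∣>_)
import Data.Maybe as Maybe
open import Data.Maybe.Properties using (just-injective)
open import Data.Nat as ℕ using (zero; _∸_; _^_; z≤n; s≤s)
import Data.Nat.Properties as ℕ
open import Data.Nat.Induction using (<-rec)
open import Data.Nat.Logarithm using (⌊log₂_⌋; ⌊log₂⌋-mono-≤; ⌊log₂[2^n]⌋≡n)
import Data.Integer as ℤ
open import Data.Integer.Tactic.RingSolver renaming (solve-∀ to ℤ-solve-∀)
open import Data.Product using (_,_; ∃; proj₁; proj₂)
open import Data.Rational using (_+_; -_; _⊓_; 1/_; nonNegative; positive; toℚᵘ; ≢-nonZero)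
import Data.Rational.Properties as ℚ
import Data.Rational.Unnormalised as ℚᵘ
import Data.Rational.Unnormalised.Properties as ℚᵘ
open import Data.Sum using (inj₁; inj₂)
open import Data.Unit using (tt)
open import Relation.Binary.PropositionalEquality using (refl; sym; trans; cong; cong₂; subst; subst₂; module ≡-Reasoning)
open import Relation.Nullary using (Dec; yes; no; ¬_; does; contradiction)
open import Relation.Nullary.Decidable using (dec⇒maybe; dec-true; dec-false)
open import Relation.Nullary.Reflects using (Reflects; ofʸ; ofⁿ)
import Tactic.RingSolver.Core.AlmostCommutativeRing as ACR
open import Tactic.RingSolver using (solve-∀)

ℚ-ring : ACR.AlmostCommutativeRing 0ℓ 0ℓ
ℚ-ring = ACR.fromCommutativeRing ℚ.+-*-commutativeRing (λ p → Maybe.map sym (dec⇒maybe (p ℚ.≟ 0ℚ)))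

p+0*q≡p : ∀ p q → p + 0ℚ * q ≡ p
p+0*q≡p = solve-∀ ℚ-ring

0+1*p≡p : ∀ p → 0ℚ + 1ℚ * p ≡ p
0+1*p≡p = solve-∀ ℚ-ring

gap⇒≤ : ∀ {p q} t → 0ℚ ≤ t → p + t ≡ q → p ≤ q
gap⇒≤ {p} {q} t 0≤t p+t≡q = subst₂ _≤_ (ℚ.+-identityʳ p) p+t≡q (ℚ.+-monoʳ-≤ p 0≤t)

p≤q⇒0≤q-p : ∀ {p q} → p ≤ q → 0ℚ ≤ q - p
p≤q⇒0≤q-p {p} {q} p≤q = subst (_≤ q - p) (ℚ.+-inverseʳ p) (ℚ.+-monoˡ-≤ (- p) p≤q)

*-monoˡ-≤-0≤ : ∀ {r p q} → 0ℚ ≤ r → p ≤ q → r * p ≤ r * q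
*-monoˡ-≤-0≤ {r} 0≤r = ℚ.*-monoˡ-≤-nonNeg r {{nonNegative 0≤r}}

*-monoʳ-≤-0≤ : ∀ {r p q} → 0ℚ ≤ r → p ≤ q → p * r ≤ q * r
*-monoʳ-≤-0≤ {r} 0≤r = ℚ.*-monoʳ-≤-nonNeg r {{nonNegative 0≤r}}

*-nonNeg : ∀ {p q} → 0ℚ ≤ p → 0ℚ ≤ q → 0ℚ ≤ p * q
*-nonNeg {p} 0≤p 0≤q = subst (_≤ p * _) (ℚ.*-zeroʳ p) (*-monoˡ-≤-0≤ 0≤p 0≤q)

affine-fixpoint-≤ : ∀ {x s p L} → 0ℚ < s → 0ℚ ≤ L → x ≤ s + p * x → s + p * L ≤ L → x ≤ L
affine-fixpoint-≤ {x} {s} {p} {L} 0<s 0≤L x≤s+px s+pL≤L =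
  ℚ.*-cancelˡ-≤-pos (1ℚ - p) {{positive 0<1-p}} (ℚ.≤-trans [1-p]x≤s s≤[1-p]L)
  where
  open ℚ.≤-Reasoning
  factor : ∀ p b → b - p * b ≡ (1ℚ - p) * b
  factor = solve-∀ ℚ-ring
  cancel : ∀ y z → y + z - z ≡ y
  cancel = solve-∀ ℚ-ring
  [1-p]x≤s : (1ℚ - p) * x ≤ s
  [1-p]x≤s = begin
    (1ℚ - p) * x         ≡⟨ factor p x ⟨
    x - p * x            ≤⟨ ℚ.+-monoˡ-≤ (- (p * x)) x≤s+px ⟩
    s + p * x - p * x    ≡⟨ cancel s (p * x) ⟩
    s                    ∎
  s≤[1-p]L : s ≤ (1ℚ - p) * L
  s≤[1-p]L = begin
    s                    ≡⟨ cancel s (p * L) ⟨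
    s + p * L - p * L    ≤⟨ ℚ.+-monoˡ-≤ (- (p * L)) s+pL≤L ⟩
    L - p * L            ≡⟨ factor p L ⟩
    (1ℚ - p) * L         ∎
  0<1-p : 0ℚ < 1ℚ - p
  0<1-p = ℚ.≰⇒> λ 1-p≤0 → ℚ.<-irrefl refl (ℚ.<-≤-trans 0<s (ℚ.≤-trans s≤[1-p]L
            (subst ((1ℚ - p) * L ≤_) (ℚ.*-zeroˡ L) (*-monoʳ-≤-0≤ 0≤L 1-p≤0))))

discounted-≤ : ∀ {e t c S L P} → 0ℚ ≤ e → e ≤ 1ℚ → 0ℚ ≤ t → t ≤ e * c → P ≤ 1ℚ → L ≤ c + S →
               (1ℚ - e) * L ≤ c + ((1ℚ - e) * S - (1ℚ - e) * t * P)
discounted-≤ {e} {t} {c} {S} {L} {P} 0≤e e≤1 0≤t t≤ec P≤1 L≤c+S = gap⇒≤ gap 0≤gap (expand e t c S L P)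
  where
  μ = 1ℚ - e
  gap = μ * (c + S - L) + (e * c - t) + t * (1ℚ - μ * P)
  μP≤1 : μ * P ≤ 1ℚ
  μP≤1 = ℚ.≤-trans (*-monoˡ-≤-0≤ (p≤q⇒0≤q-p e≤1) P≤1)
           (subst (_≤ 1ℚ) (sym (ℚ.*-identityʳ μ)) (gap⇒≤ e 0≤e (sym (minus-plus e))))
    where
    minus-plus : ∀ a → 1ℚ ≡ 1ℚ - a + a
    minus-plus = solve-∀ ℚ-ring
  0≤gap : 0ℚ ≤ gap
  0≤gap = ℚ.+-mono-≤ (ℚ.+-mono-≤ (*-nonNeg (p≤q⇒0≤q-p e≤1) (p≤q⇒0≤q-p L≤c+S)) (p≤q⇒0≤q-p t≤ec))
                     (*-nonNeg 0≤t (p≤q⇒0≤q-p μP≤1))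
  expand : ∀ e t c S L P → (1ℚ - e) * L + ((1ℚ - e) * (c + S - L) + (e * c - t) + t * (1ℚ - (1ℚ - e) * P))
                          ≡ c + ((1ℚ - e) * S - (1ℚ - e) * t * P)
  expand = solve-∀ ℚ-ring

ℕ→ℚ-suc : ∀ k → ℕ→ℚ (suc k) ≡ 1ℚ + ℕ→ℚ k
ℕ→ℚ-suc k = ℚ.toℚᵘ-injective (begin
  toℚᵘ (ℕ→ℚ (suc k))              ≈⟨ ℚ.toℚᵘ-fromℚᵘ (ℚᵘ.mkℚᵘ (+ suc k) 0) ⟩
  ℚᵘ.mkℚᵘ (+ suc k) 0             ≈⟨ ℚᵘ.*≡* (cross-multiplied (+ k)) ⟩
  toℚᵘ 1ℚ ℚᵘ.+ ℚᵘ.mkℚᵘ (+ k) 0    ≈⟨ ℚᵘ.+-congʳ (toℚᵘ 1ℚ) (ℚᵘ.≃-sym (ℚ.toℚᵘ-fromℚᵘ (ℚᵘ.mkℚᵘ (+ k) 0))) ⟩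
  toℚᵘ 1ℚ ℚᵘ.+ toℚᵘ (ℕ→ℚ k)       ≈⟨ ℚᵘ.≃-sym (ℚ.toℚᵘ-homo-+ 1ℚ (ℕ→ℚ k)) ⟩
  toℚᵘ (1ℚ + ℕ→ℚ k)               ∎)
  where
  open import Relation.Binary.Reasoning.Setoid ℚᵘ.≃-setoid
  cross-multiplied : ∀ x → (+ 1 ℤ.+ x) ℤ.* (+ 1 ℤ.* + 1) ≡ (+ 1 ℤ.* + 1 ℤ.+ x ℤ.* + 1) ℤ.* + 1
  cross-multiplied = ℤ-solve-∀

ℕ→ℚ-+ : ∀ a b → ℕ→ℚ (a ℕ.+ b) ≡ ℕ→ℚ a + ℕ→ℚ b
ℕ→ℚ-+ zero    b = sym (ℚ.+-identityˡ (ℕ→ℚ b))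
ℕ→ℚ-+ (suc a) b = begin
  ℕ→ℚ (suc (a ℕ.+ b))     ≡⟨ ℕ→ℚ-suc (a ℕ.+ b) ⟩
  1ℚ + ℕ→ℚ (a ℕ.+ b)      ≡⟨ cong (λ x → 1ℚ + x) (ℕ→ℚ-+ a b) ⟩
  1ℚ + (ℕ→ℚ a + ℕ→ℚ b)    ≡⟨ ℚ.+-assoc 1ℚ (ℕ→ℚ a) (ℕ→ℚ b) ⟨
  (1ℚ + ℕ→ℚ a) + ℕ→ℚ b    ≡⟨ cong (_+ ℕ→ℚ b) (ℕ→ℚ-suc a) ⟨
  ℕ→ℚ (suc a) + ℕ→ℚ b     ∎
  where open ≡-Reasoning

ℕ→ℚ-* : ∀ a b → ℕ→ℚ (a ℕ.* b) ≡ ℕ→ℚ a * ℕ→ℚ b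
ℕ→ℚ-* zero    b = sym (ℚ.*-zeroˡ (ℕ→ℚ b))
ℕ→ℚ-* (suc a) b = begin
  ℕ→ℚ (b ℕ.+ a ℕ.* b)       ≡⟨ ℕ→ℚ-+ b (a ℕ.* b) ⟩
  ℕ→ℚ b + ℕ→ℚ (a ℕ.* b)     ≡⟨ cong (λ x → ℕ→ℚ b + x) (ℕ→ℚ-* a b) ⟩
  ℕ→ℚ b + ℕ→ℚ a * ℕ→ℚ b     ≡⟨ distrib (ℕ→ℚ a) (ℕ→ℚ b) ⟩
  (1ℚ + ℕ→ℚ a) * ℕ→ℚ b      ≡⟨ cong (_* ℕ→ℚ b) (ℕ→ℚ-suc a) ⟨
  ℕ→ℚ (suc a) * ℕ→ℚ b       ∎
  where
  open ≡-Reasoning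
  distrib : ∀ x y → y + x * y ≡ (1ℚ + x) * y
  distrib = solve-∀ ℚ-ring

ℕ→ℚ-nonNeg : ∀ a → 0ℚ ≤ ℕ→ℚ a
ℕ→ℚ-nonNeg zero    = ℚ.≤-refl
ℕ→ℚ-nonNeg (suc a) = subst (0ℚ ≤_) (sym (ℕ→ℚ-suc a)) (ℚ.+-mono-≤ (ℚ.nonNegative⁻¹ 1ℚ) (ℕ→ℚ-nonNeg a))

ℕ→ℚ-mono-≤ : ∀ {a b} → a ≤ℕ b → ℕ→ℚ a ≤ ℕ→ℚ b
ℕ→ℚ-mono-≤ {a} {b} a≤b = gap⇒≤ (ℕ→ℚ (b ∸ a)) (ℕ→ℚ-nonNeg (b ∸ a))
  (trans (sym (ℕ→ℚ-+ a (b ∸ a))) (cong ℕ→ℚ (ℕ.m+[n∸m]≡n a≤b)))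

ℕ→ℚ-pos : ∀ a .{{_ : ℕ.NonZero a}} → 0ℚ < ℕ→ℚ a
ℕ→ℚ-pos a = ℚ.<-≤-trans (ℚ.positive⁻¹ 1ℚ) (ℕ→ℚ-mono-≤ {1} {a} (ℕ.>-nonZero⁻¹ a))

÷'-*-cancel : ∀ p {q} → 0ℚ < q → (p ÷' q) * q ≡ p
÷'-*-cancel p {q} 0<q with q ℚ.≟ 0ℚ
... | yes q≡0 = contradiction (sym q≡0) (ℚ.<⇒≢ 0<q)
... | no  q≢0 = begin
  p * 1/ q * q    ≡⟨ ℚ.*-assoc p _ q ⟩
  p * (1/ q * q)  ≡⟨ cong (p *_) (ℚ.*-inverseˡ q) ⟩
  p * 1ℚ          ≡⟨ ℚ.*-identityʳ p ⟩
  p               ∎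
  where
  open ≡-Reasoning
  instance _ = ≢-nonZero q≢0

÷'-nonNeg : ∀ {p q} → 0ℚ ≤ p → 0ℚ < q → 0ℚ ≤ p ÷' q
÷'-nonNeg {p} {q} 0≤p 0<q = ℚ.*-cancelʳ-≤-pos q {{positive 0<q}}
  (subst₂ _≤_ (sym (ℚ.*-zeroˡ q)) (sym (÷'-*-cancel p 0<q)) 0≤p)

÷'-unique : ∀ {x p q} → 0ℚ < q → x * q ≡ p → x ≡ p ÷' q
÷'-unique {x} {p} {q} 0<q xq≡p = ℚ.≤-antisym (cancel (ℚ.≤-reflexive same)) (cancel (ℚ.≤-reflexive (sym same)))
  where
  cancel : ∀ {a b} → a * q ≤ b * q → a ≤ b
  cancel = ℚ.*-cancelʳ-≤-pos q {{positive 0<q}}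
  same : x * q ≡ (p ÷' q) * q
  same = trans xq≡p (sym (÷'-*-cancel p 0<q))

Σ₁-cong : ∀ N {f h : ℕ → ℚ} → (∀ k → 1 ≤ℕ k → k ≤ℕ N → f k ≡ h k) → Σ₁ N f ≡ Σ₁ N h
Σ₁-cong zero    f≡h = refl
Σ₁-cong (suc N) f≡h = cong₂ _+_ (Σ₁-cong N λ k 1≤k k≤N → f≡h k 1≤k (ℕ.m≤n⇒m≤1+n k≤N))
                                (f≡h (suc N) (s≤s z≤n) ℕ.≤-refl)

Σ₁-mono-≤ : ∀ N {f h : ℕ → ℚ} → (∀ k → 1 ≤ℕ k → k ≤ℕ N → f k ≤ h k) → Σ₁ N f ≤ Σ₁ N h
Σ₁-mono-≤ zero    f≤h = ℚ.≤-refl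
Σ₁-mono-≤ (suc N) f≤h = ℚ.+-mono-≤ (Σ₁-mono-≤ N λ k 1≤k k≤N → f≤h k 1≤k (ℕ.m≤n⇒m≤1+n k≤N))
                                   (f≤h (suc N) (s≤s z≤n) ℕ.≤-refl)

Σ₁-zero : ∀ N → Σ₁ N (λ _ → 0ℚ) ≡ 0ℚ
Σ₁-zero zero    = refl
Σ₁-zero (suc N) = cong (_+ 0ℚ) (Σ₁-zero N)

Σ₁-nonNeg : ∀ N {f : ℕ → ℚ} → (∀ k → 1 ≤ℕ k → k ≤ℕ N → 0ℚ ≤ f k) → 0ℚ ≤ Σ₁ N f
Σ₁-nonNeg N {f} 0≤f = subst (_≤ Σ₁ N f) (Σ₁-zero N) (Σ₁-mono-≤ N 0≤f)

Σ₁-+ : ∀ N (f h : ℕ → ℚ) → Σ₁ N (λ k → f k + h k) ≡ Σ₁ N f + Σ₁ N h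
Σ₁-+ zero    f h = refl
Σ₁-+ (suc N) f h = trans (cong (_+ (f (suc N) + h (suc N))) (Σ₁-+ N f h))
                         (interchange (Σ₁ N f) (Σ₁ N h) (f (suc N)) (h (suc N)))
  where
  interchange : ∀ a b x y → (a + b) + (x + y) ≡ (a + x) + (b + y)
  interchange = solve-∀ ℚ-ring

Σ₁-*ˡ : ∀ N a (f : ℕ → ℚ) → Σ₁ N (λ k → a * f k) ≡ a * Σ₁ N f
Σ₁-*ˡ zero    a f = sym (ℚ.*-zeroʳ a)
Σ₁-*ˡ (suc N) a f = trans (cong (_+ (a * f (suc N))) (Σ₁-*ˡ N a f))
                          (sym (ℚ.*-distribˡ-+ a (Σ₁ N f) (f (suc N))))

Σ₁-linear : ∀ N a (f h : ℕ → ℚ) → Σ₁ N (λ k → f k + a * h k) ≡ Σ₁ N f + a * Σ₁ N h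
Σ₁-linear N a f h = trans (Σ₁-+ N f (λ k → a * h k)) (cong (λ x → Σ₁ N f + x) (Σ₁-*ˡ N a h))

Σ₁-≤-extend : ∀ {N M} {f : ℕ → ℚ} → N ≤ℕ M → (∀ k → N <ℕ k → k ≤ℕ M → 0ℚ ≤ f k) → Σ₁ N f ≤ Σ₁ M f
Σ₁-≤-extend {M = zero}  z≤n _ = ℚ.≤-refl
Σ₁-≤-extend {N} {suc M} {f} N≤1+M 0≤f with ℕ.m≤n⇒m<n∨m≡n N≤1+M
... | inj₂ refl        = ℚ.≤-refl
... | inj₁ (s≤s N≤M) = ℚ.≤-trans (Σ₁-≤-extend N≤M (λ k N<k k≤M → 0≤f k N<k (ℕ.m≤n⇒m≤1+n k≤M)))
                                 (gap⇒≤ (f (suc M)) (0≤f (suc M) (s≤s N≤M) ℕ.≤-refl) refl)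

Σ₁-extend-zeros : ∀ {N M} {f : ℕ → ℚ} → N ≤ℕ M → (∀ k → N <ℕ k → k ≤ℕ M → f k ≡ 0ℚ) → Σ₁ M f ≡ Σ₁ N f
Σ₁-extend-zeros {M = zero}  z≤n _ = refl
Σ₁-extend-zeros {N} {suc M} {f} N≤1+M f≡0 with ℕ.m≤n⇒m<n∨m≡n N≤1+M
... | inj₂ refl        = refl
... | inj₁ (s≤s N≤M) = begin
  Σ₁ M f + f (suc M)  ≡⟨ cong₂ _+_ (Σ₁-extend-zeros N≤M (λ k N<k k≤M → f≡0 k N<k (ℕ.m≤n⇒m≤1+n k≤M)))
                                   (f≡0 (suc M) (s≤s N≤M) ℕ.≤-refl) ⟩
  Σ₁ N f + 0ℚ         ≡⟨ ℚ.+-identityʳ (Σ₁ N f) ⟩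
  Σ₁ N f              ∎
  where open ≡-Reasoning

Σ₁-shift : ∀ N (f : ℕ → ℚ) → Σ₁ (suc N) f ≡ f 1 + Σ₁ N (λ k → f (suc k))
Σ₁-shift zero    f = trans (ℚ.+-identityˡ (f 1)) (sym (ℚ.+-identityʳ (f 1)))
Σ₁-shift (suc N) f = trans (cong (_+ f (suc (suc N))) (Σ₁-shift N f)) (ℚ.+-assoc (f 1) _ _)

Σ₁-reverse : ∀ N (f : ℕ → ℚ) → Σ₁ N (λ k → f (suc N ∸ k)) ≡ Σ₁ N f
Σ₁-reverse zero    f = refl
Σ₁-reverse (suc N) f = begin
  Σ₁ N (λ k → f (2 ℕ.+ N ∸ k)) + f (2 ℕ.+ N ∸ suc N)
    ≡⟨ cong₂ _+_ (Σ₁-cong N (λ k _ k≤N → cong f (ℕ.+-∸-assoc 1 (ℕ.m≤n⇒m≤1+n k≤N))))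
                 (cong f (ℕ.m+n∸n≡m 1 (suc N))) ⟩
  Σ₁ N (λ k → f (suc (suc N ∸ k))) + f 1
    ≡⟨ cong (_+ f 1) (Σ₁-reverse N (λ k → f (suc k))) ⟩
  Σ₁ N (λ k → f (suc k)) + f 1
    ≡⟨ ℚ.+-comm _ (f 1) ⟩
  f 1 + Σ₁ N (λ k → f (suc k))
    ≡⟨ Σ₁-shift N f ⟨
  Σ₁ (suc N) f ∎
  where open ≡-Reasoning

if-just-<∣> : ∀ {A : Set} b (x : A) (y z : Maybe A) →
              (if b then just x else (y <∣> z)) ≡ (if b then just x else y) <∣> z
if-just-<∣> true  x y z = refl
if-just-<∣> false x y z = refl

does-true : ∀ {P : Set} (a? : Dec P) → does a? ≡ true → P
does-true (yes p) _ = p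

does-false : ∀ {P : Set} (a? : Dec P) → does a? ≡ false → ¬ P
does-false (no ¬p) _ = ¬p

minFin-≤ : ∀ {m} (f : Fin (suc m) → ℚ) i → minFin f ≤ f i
minFin-≤ {zero}  f zero    = ℚ.≤-refl
minFin-≤ {suc m} f zero    = ℚ.p⊓q≤p (f zero) _
minFin-≤ {suc m} f (suc i) = ℚ.≤-trans (ℚ.p⊓q≤q (f zero) _) (minFin-≤ (λ j → f (suc j)) i)

minFin-greatest : ∀ {m} {f : Fin (suc m) → ℚ} {a} → (∀ i → a ≤ f i) → a ≤ minFin f
minFin-greatest {zero}  a≤f = a≤f zero
minFin-greatest {suc m} a≤f = ℚ.⊓-glb (a≤f zero) (minFin-greatest (λ j → a≤f (suc j)))

minFin-mono-≤ : ∀ {m} {f h : Fin (suc m) → ℚ} → (∀ i → f i ≤ h i) → minFin f ≤ minFin h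
minFin-mono-≤ {f = f} f≤h = minFin-greatest λ i → ℚ.≤-trans (minFin-≤ f i) (f≤h i)

minFin-cong : ∀ {m} {f h : Fin (suc m) → ℚ} → (∀ i → f i ≡ h i) → minFin f ≡ minFin h
minFin-cong {zero}  f≡h = f≡h zero
minFin-cong {suc m} f≡h = cong₂ _⊓_ (f≡h zero) (minFin-cong (λ j → f≡h (suc j)))

anyFin-true : ∀ {m} (f : Fin (suc m) → Bool) → anyFin f ≡ true → ∃ λ i → f i ≡ true
anyFin-true {zero}  f any = zero , any
anyFin-true {suc m} f any with f zero in f0
... | true  = zero , f0
... | false = let i , fi = anyFin-true (λ j → f (suc j)) any in suc i , fi

anyFin-false : ∀ {m} (f : Fin (suc m) → Bool) → anyFin f ≡ false → ∀ i → f i ≡ false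
anyFin-false {zero}  f none zero = none
anyFin-false {suc m} f none i with f zero in f0
anyFin-false {suc m} f none zero    | false = f0
anyFin-false {suc m} f none (suc i) | false = anyFin-false (λ j → f (suc j)) none i

n<2^[1+⌊log₂n⌋] : ∀ n → n <ℕ 2 ^ suc ⌊log₂ n ⌋
n<2^[1+⌊log₂n⌋] n = ℕ.≰⇒> λ 2^[1+k]≤n →
  ℕ.n≮n ⌊log₂ n ⌋ (subst (_≤ℕ ⌊log₂ n ⌋) (⌊log₂[2^n]⌋≡n (suc ⌊log₂ n ⌋)) (⌊log₂⌋-mono-≤ 2^[1+k]≤n))

module DPAnalysis (m W : ℕ) (c : Fin (suc m) → ℚ) (d : Fin (suc m) → ℕ → ℚ) (ε : ℚ) where
  open Knapsack m W c d ε

  -- For G = g this is the quantity compared with iδT when testing w' = u + 1.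
  insertCost : (ℕ → ℚ) → Fin n → ℕ → ℚ
  insertCost G k u = c k + Σ₁ u (λ j → d k (suc u ∸ j) * G j)

  optTable≡OPT : ∀ {w v} → v ≤ℕ w → optTable w v ≡ OPT v
  optTable≡OPT {zero}      z≤n    = refl
  optTable≡OPT {suc w} {v} v≤1+w with ℕ.m≤n⇒m<n∨m≡n v≤1+w
  ... | inj₂ refl       = refl
  ... | inj₁ (s≤s v≤w) rewrite dec-true (v ℕ.≤? w) v≤w = optTable≡OPT v≤w

  OPT-suc : ∀ u → OPT (suc u) ≡ minFin (λ k → c k + Σ₁ W (λ l → d k l * OPT (suc u ∸ l)))
  OPT-suc u = begin
    OPT (suc u)                         ≡⟨ cong (λ b → if b then optTable u (suc u) else optStep (optTable u) (suc u))
                                                (dec-false (u ℕ.<? u) (ℕ.n≮n u)) ⟩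
    optStep (optTable u) (suc u)        ≡⟨ minFin-cong (λ k → cong (λ x → c k + x)
                                             (Σ₁-cong W λ l 1≤l _ → cong (λ x → d k l * x) (table-entry l 1≤l))) ⟩
    minFin (λ k → c k + Σ₁ W (λ l → d k l * OPT (suc u ∸ l))) ∎
    where
    open ≡-Reasoning
    table-entry : ∀ l → 1 ≤ℕ l → (if l ℕ.<ᵇ suc u then optTable u (suc u ∸ l) else 0ℚ) ≡ OPT (suc u ∸ l)
    table-entry l 1≤l with l ℕ.<ᵇ suc u | ℕ.<ᵇ-reflects-< l (suc u)
    ... | true  | ofʸ _     = optTable≡OPT (ℕ.∸-monoʳ-≤ (suc u) 1≤l)
    ... | false | ofⁿ l≮1+u = cong OPT (sym (ℕ.m≤n⇒m∸n≡0 (ℕ.≮⇒≥ l≮1+u)))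

  OPT-insert : ∀ {u} → u ≤ℕ W → OPT (suc u) ≡ minFin (λ k → insertCost OPT k u)
  OPT-insert {u} u≤W = trans (OPT-suc u) (minFin-cong λ k → cong (λ x → c k + x) (begin
    Σ₁ W (λ l → d k l * OPT (suc u ∸ l))            ≡⟨ Σ₁-extend-zeros u≤W (λ l u<l _ →
                                                         trans (cong (λ v → d k l * OPT v) (ℕ.m≤n⇒m∸n≡0 u<l)) (ℚ.*-zeroʳ (d k l))) ⟩
    Σ₁ u (λ l → d k l * OPT (suc u ∸ l))            ≡⟨ Σ₁-reverse u (λ l → d k l * OPT (suc u ∸ l)) ⟨
    Σ₁ u (λ j → d k (suc u ∸ j) * OPT (suc u ∸ (suc u ∸ j)))
                                                     ≡⟨ Σ₁-cong u (λ j _ j≤u → cong (λ v → d k (suc u ∸ j) * OPT v)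
                                                                                  (ℕ.m∸[m∸n]≡n (ℕ.m≤n⇒m≤1+n j≤u))) ⟩
    Σ₁ u (λ j → d k (suc u ∸ j) * OPT j)            ∎))
    where open ≡-Reasoning

  inBracket : (ℕ → ℕ) → ℕ → ℕ → Bool
  inBracket F w x = (F (x ∸ 1) ℕ.<ᵇ w) ∧ (w ℕ.≤ᵇ F x)

  findJ-snoc : ∀ F w j r → findJ F w j (suc r) ≡ findJ F w j r <∣> (if inBracket F w (j ℕ.+ r) then just (j ℕ.+ r) else nothing)
  findJ-snoc F w j zero    rewrite ℕ.+-identityʳ j = refl
  findJ-snoc F w j (suc r) rewrite ℕ.+-suc j r | findJ-snoc F w (suc j) r =
    if-just-<∣> (inBracket F w j) j (findJ F w (suc j) r) _

  findJ-cong : ∀ {F G} w j r → (∀ x → x <ℕ j ℕ.+ r → F x ≡ G x) → findJ F w j r ≡ findJ G w j r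
  findJ-cong w j zero    F≡G = refl
  findJ-cong w j (suc r) F≡G = cong₂ (λ b z → if b then just j else z)
    (cong₂ (λ a b → (a ℕ.<ᵇ w) ∧ (w ℕ.≤ᵇ b)) (F≡G (j ∸ 1) (ℕ.≤-<-trans (ℕ.m∸n≤m j 1) j<j+1+r)) (F≡G j j<j+1+r))
    (findJ-cong w (suc j) r λ x x< → F≡G x (subst (x <ℕ_) (sym (ℕ.+-suc j r)) x<))
    where
    j<j+1+r : j <ℕ j ℕ.+ suc r
    j<j+1+r = ℕ.m<m+n j (s≤s z≤n)

  -- The thresholds f_0, …, f_{r+1} as `loop` stores them after round r + 1.
  extend : (ℕ → ℕ) → ℕ → ℕ → ℕ
  extend F r x = if x ℕ.≡ᵇ suc r then fNext F (suc r) else F x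

  extend-old : ∀ F r {x} → x ≤ℕ r → extend F r x ≡ F x
  extend-old F r {x} x≤r =
    cong (λ b → if b then fNext F (suc r) else F x) (dec-false (x ℕ.≟ suc r) (ℕ.<⇒≢ (s≤s x≤r)))

  extend-new : ∀ F r → extend F r (suc r) ≡ fNext F (suc r)
  extend-new F r = cong (λ b → if b then fNext F (suc r) else F (suc r)) (dec-true (suc r ℕ.≟ suc r) refl)

  newBracket : (ℕ → ℕ) → ℕ → ℕ → Maybe ℕ
  newBracket F r w = if (F r ℕ.<ᵇ w) ∧ (w ℕ.≤ᵇ fNext F (suc r)) then just (suc r) else nothing

  findJ-extend : ∀ F r w → findJ (extend F r) w 1 (suc r) ≡ findJ F w 1 r <∣> newBracket F r w
  findJ-extend F r w = trans (findJ-snoc (extend F r) w 1 r) (cong₂ _<∣>_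
    (findJ-cong w 1 r λ x x<1+r → extend-old F r (ℕ.≤-pred x<1+r))
    (cong (λ b → if b then just (suc r) else nothing)
          (cong₂ (λ a b → (a ℕ.<ᵇ w) ∧ (w ℕ.≤ᵇ b)) (extend-old F r ℕ.≤-refl) (extend-new F r))))

  findJ-extend-unsettled : ∀ {F r w} → findJ F w 1 r ≡ nothing → F r <ℕ w →
                           findJ (extend F r) w 1 (suc r) ≡ (if w ℕ.≤ᵇ fNext F (suc r) then just (suc r) else nothing)
  findJ-extend-unsettled {F} {r} {w} φ F[r]<w = trans (findJ-extend F r w) (cong₂ _<∣>_ φ
    (cong (λ b → if b ∧ (w ℕ.≤ᵇ fNext F (suc r)) then just (suc r) else nothing) (dec-true (F r ℕ.<? w) F[r]<w)))

  data Refinement (F : ℕ → ℕ) (r w : ℕ) : Set where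
    kept          : ∀ {j} → findJ F w 1 r ≡ just j → findJ (extend F r) w 1 (suc r) ≡ just j → Refinement F r w
    newly-settled : findJ F w 1 r ≡ nothing → w ≤ℕ fNext F (suc r) →
                    findJ (extend F r) w 1 (suc r) ≡ just (suc r) → Refinement F r w
    still-pending : findJ F w 1 r ≡ nothing → fNext F (suc r) <ℕ w →
                    findJ (extend F r) w 1 (suc r) ≡ nothing → Refinement F r w

  refine : ∀ F r w → (findJ F w 1 r ≡ nothing → F r <ℕ w) → Refinement F r w
  refine F r w beyond with findJ F w 1 r in φ
  ... | just j  = kept φ (trans (findJ-extend F r w) (cong (_<∣> newBracket F r w) φ))
  ... | nothing with w ℕ.≤? fNext F (suc r)
  ...   | yes w≤f = newly-settled φ w≤f (trans (findJ-extend-unsettled φ (beyond refl))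
                      (cong (λ b → if b then just (suc r) else nothing) (dec-true (w ℕ.≤? _) w≤f)))
  ...   | no  w≰f = still-pending φ (ℕ.≰⇒> w≰f) (trans (findJ-extend-unsettled φ (beyond refl))
                      (cong (λ b → if b then just (suc r) else nothing) (dec-false (w ℕ.≤? _) w≰f)))

  bracketLevel : ℕ → Maybe ℕ → ℚ
  bracketLevel i (just j) = lvl j
  bracketLevel i nothing  = lvl i

  g≡bracketLevel : ∀ F r w → g F (suc r) w ≡ bracketLevel (suc r) (findJ F w 1 r)
  g≡bracketLevel F r w with findJ F w 1 r
  ... | just _  = refl
  ... | nothing = refl

  g-settled : ∀ F r w {j} → findJ F w 1 r ≡ just j → g F (suc r) w ≡ lvl j
  g-settled F r w φ = trans (g≡bracketLevel F r w) (cong (bracketLevel (suc r)) φ)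

  g-pending : ∀ F r w → findJ F w 1 r ≡ nothing → g F (suc r) w ≡ lvl (suc r)
  g-pending F r w φ = trans (g≡bracketLevel F r w) (cong (bracketLevel (suc r)) φ)

  settledPart pendingPart : Maybe ℕ → ℚ
  settledPart (just j) = lvl j
  settledPart nothing  = 0ℚ
  pendingPart (just _) = 0ℚ
  pendingPart nothing  = 1ℚ

  bracketLevel-split : ∀ i φ → bracketLevel i φ ≡ settledPart φ + pendingPart φ * lvl i
  bracketLevel-split i (just j) = sym (p+0*q≡p (lvl j) (lvl i))
  bracketLevel-split i nothing  = sym (0+1*p≡p (lvl i))

  -- Case analyses below take the scrutinee as an argument instead of using `with`:
  -- with-abstraction normalises the goal, and unfolding `lvl` there (through δ, T and
  -- the normalisation of rationals) makes type checking prohibitively slow.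
  maxFeas-witness : ∀ F i v {w} → 1 ≤ℕ w → w ≤ℕ maxFeas F i v →
                    ∃ λ u → w ≤ℕ suc u × suc u ≤ℕ v × feasible F i (suc u) ≡ true
  maxFeas-witness F i zero    1≤w w≤0 = contradiction (ℕ.≤-trans 1≤w w≤0) λ ()
  maxFeas-witness F i (suc v) {w} 1≤w = by-test (feasible F i (suc v)) refl
    where
    by-test : ∀ b → feasible F i (suc v) ≡ b → w ≤ℕ (if b then suc v else maxFeas F i v) →
              ∃ λ u → w ≤ℕ suc u × suc u ≤ℕ suc v × feasible F i (suc u) ≡ true
    by-test true  feas w≤1+v = v , w≤1+v , ℕ.≤-refl , feas
    by-test false _    w≤f   = let u , w≤1+u , 1+u≤v , feas = maxFeas-witness F i v 1≤w w≤f in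
                               u , w≤1+u , ℕ.m≤n⇒m≤1+n 1+u≤v , feas

  maxFeas-maximal : ∀ F i v {w} → w ≤ℕ v → maxFeas F i v <ℕ w → feasible F i w ≡ false
  maxFeas-maximal F i zero    z≤n ()
  maxFeas-maximal F i (suc v) {w} w≤1+v = by-test (feasible F i (suc v)) refl
    where
    by-test : ∀ b → feasible F i (suc v) ≡ b → (if b then suc v else maxFeas F i v) <ℕ w → feasible F i w ≡ false
    by-test true  _       1+v<w = contradiction w≤1+v (ℕ.<⇒≱ 1+v<w)
    by-test false infeas  f<w = by-position (ℕ.m≤n⇒m<n∨m≡n w≤1+v)
      where
      by-position : w <ℕ suc v ⊎ w ≡ suc v → feasible F i w ≡ false
      by-position (inj₁ (s≤s w≤v)) = maxFeas-maximal F i v w≤v f<w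
      by-position (inj₂ w≡1+v)      = subst (λ x → feasible F i x ≡ false) (sym w≡1+v) infeas

  feasible-witness : ∀ F i u → feasible F i (suc u) ≡ true → ∃ λ k → insertCost (g F i) k u ≤ lvl i
  feasible-witness F i u feas = let k , test = anyFin-true _ feas in k , does-true (insertCost (g F i) k u ℚ.≤? lvl i) test

  infeasible-all : ∀ F i u → feasible F i (suc u) ≡ false → ∀ k → lvl i < insertCost (g F i) k u
  infeasible-all F i u infeas k = ℚ.≰⇒> (does-false (insertCost (g F i) k u ℚ.≤? lvl i) (anyFin-false _ infeas k))

  insertCost-cong : ∀ {G H} k u → (∀ j → 1 ≤ℕ j → j ≤ℕ u → G j ≡ H j) → insertCost G k u ≡ insertCost H k u
  insertCost-cong k u G≡H = cong (λ x → c k + x) (Σ₁-cong u λ j 1≤j j≤u → cong (λ x → d k (suc u ∸ j) * x) (G≡H j 1≤j j≤u))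

  insertCost-affine : ∀ (A B : ℕ → ℚ) X k u →
    insertCost (λ j → A j + B j * X) k u ≡ insertCost A k u + Σ₁ u (λ j → d k (suc u ∸ j) * B j) * X
  insertCost-affine A B X k u = begin
    c k + Σ₁ u (λ j → D j * (A j + B j * X))            ≡⟨ cong (λ x → c k + x) (Σ₁-cong u λ j _ _ → spread (D j) (A j) (B j) X) ⟩
    c k + Σ₁ u (λ j → D j * A j + X * (D j * B j))      ≡⟨ cong (λ x → c k + x) (Σ₁-linear u X _ _) ⟩
    c k + (Σ₁ u (λ j → D j * A j) + X * Σ₁ u (λ j → D j * B j))
                                                        ≡⟨ regroup (c k) _ X _ ⟩
    c k + Σ₁ u (λ j → D j * A j) + Σ₁ u (λ j → D j * B j) * X ∎
    where
    open ≡-Reasoning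
    D : ℕ → ℚ
    D j = d k (suc u ∸ j)
    spread : ∀ a x b y → a * (x + b * y) ≡ a * x + y * (a * b)
    spread = solve-∀ ℚ-ring
    regroup : ∀ a s x p → a + (s + x * p) ≡ a + s + p * x
    regroup = solve-∀ ℚ-ring

  insertCost-discount : ∀ (G : ℕ → ℚ) a t k u →
    insertCost (λ j → a * (G j - t)) k u ≡ c k + (a * Σ₁ u (λ j → d k (suc u ∸ j) * G j) - a * t * Σ₁ u (λ j → d k (suc u ∸ j)))
  insertCost-discount G a t k u = cong (λ x → c k + x) (begin
    Σ₁ u (λ j → D j * (a * (G j - t)))                  ≡⟨ Σ₁-cong u (λ j _ _ → spread (D j) a (G j) t) ⟩
    Σ₁ u (λ j → a * (D j * G j) + (- (a * t)) * D j)    ≡⟨ Σ₁-+ u _ _ ⟩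
    Σ₁ u (λ j → a * (D j * G j)) + Σ₁ u (λ j → (- (a * t)) * D j)
                                                        ≡⟨ cong₂ _+_ (Σ₁-*ˡ u a _) (Σ₁-*ˡ u (- (a * t)) D) ⟩
    a * Σ₁ u (λ j → D j * G j) + (- (a * t)) * Σ₁ u D   ≡⟨ negate (a * Σ₁ u (λ j → D j * G j)) (a * t) (Σ₁ u D) ⟩
    a * Σ₁ u (λ j → D j * G j) - a * t * Σ₁ u D         ∎)
    where
    open ≡-Reasoning
    D : ℕ → ℚ
    D j = d k (suc u ∸ j)
    spread : ∀ x a y t → x * (a * (y - t)) ≡ a * (x * y) + (- (a * t)) * x
    spread = solve-∀ ℚ-ring
    negate : ∀ s z p → s + (- z) * p ≡ s - z * p
    negate = solve-∀ ℚ-ring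

  module Monotone (c≥0 : ∀ k → 0ℚ ≤ c k) (d≥0 : ∀ k l → 0ℚ ≤ d k l) where

    insertCost-mono-≤ : ∀ {G H} k u → (∀ j → 1 ≤ℕ j → j ≤ℕ u → G j ≤ H j) → insertCost G k u ≤ insertCost H k u
    insertCost-mono-≤ k u G≤H = ℚ.+-monoʳ-≤ (c k) (Σ₁-mono-≤ u λ j 1≤j j≤u → *-monoˡ-≤-0≤ (d≥0 k (suc u ∸ j)) (G≤H j 1≤j j≤u))

    OPT-nonNeg : ∀ v → 0ℚ ≤ OPT v
    OPT-nonNeg = <-rec _ λ where
      zero    _   → ℚ.≤-refl
      (suc u) rec → subst (0ℚ ≤_) (sym (OPT-suc u)) (minFin-greatest λ k →
        ℚ.+-mono-≤ (c≥0 k) (Σ₁-nonNeg W λ l 1≤l _ → *-nonNeg (d≥0 k l) (rec (s≤s (ℕ.∸-monoʳ-≤ (suc u) 1≤l)))))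

    OPT-≤-suc : ∀ v → OPT v ≤ OPT (suc v)
    OPT-≤-suc = <-rec _ step
      where
      residual-≤ : ∀ {u} → (∀ {y} → y <ℕ suc u → OPT y ≤ OPT (suc y)) →
                   ∀ l → 1 ≤ℕ l → OPT (suc u ∸ l) ≤ OPT (suc (suc u) ∸ l)
      residual-≤ {u} rec l 1≤l with l ℕ.≤? suc u
      ... | yes l≤1+u = subst (λ v → OPT (suc u ∸ l) ≤ OPT v) (sym (ℕ.+-∸-assoc 1 l≤1+u))
                              (rec (s≤s (ℕ.∸-monoʳ-≤ (suc u) 1≤l)))
      ... | no  l≰1+u = subst (λ v → OPT v ≤ OPT (suc (suc u) ∸ l)) (sym (ℕ.m≤n⇒m∸n≡0 (ℕ.<⇒≤ (ℕ.≰⇒> l≰1+u))))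
                              (OPT-nonNeg (suc (suc u) ∸ l))
      step : ∀ v → (∀ {y} → y <ℕ v → OPT y ≤ OPT (suc y)) → OPT v ≤ OPT (suc v)
      step zero    _   = OPT-nonNeg 1
      step (suc u) rec = subst₂ _≤_ (sym (OPT-suc u)) (sym (OPT-suc (suc u))) (minFin-mono-≤ λ k →
        ℚ.+-monoʳ-≤ (c k) (Σ₁-mono-≤ W λ l 1≤l _ → *-monoˡ-≤-0≤ (d≥0 k l) (residual-≤ rec l 1≤l)))

    OPT-mono-≤ : ∀ {v w} → v ≤ℕ w → OPT v ≤ OPT w
    OPT-mono-≤ {w = zero}  z≤n   = ℚ.≤-refl
    OPT-mono-≤ {w = suc w} v≤1+w with ℕ.m≤n⇒m<n∨m≡n v≤1+w
    ... | inj₂ refl       = ℚ.≤-refl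
    ... | inj₁ (s≤s v≤w) = ℚ.≤-trans (OPT-mono-≤ v≤w) (OPT-≤-suc w)

  module LowerBound (c>0 : ∀ k → 0ℚ < c k) (d≥0 : ∀ k l → 0ℚ ≤ d k l) (Σd≡1 : ∀ k → Σ₁ W (d k) ≡ 1ℚ) where

    half : ℚ
    half = + 1 / 2

    ρ : ℚ
    ρ = minFin (λ i → c i ÷' Ebar i)

    Ebar-pos : ∀ k → 0ℚ < Ebar k
    Ebar-pos k = ℚ.<-≤-trans (ℚ.positive⁻¹ 1ℚ) (begin
      1ℚ                                          ≡⟨ Σd≡1 k ⟨
      Σ₁ W (d k)                                  ≡⟨ Σ₁-cong W (λ j _ _ → ℚ.*-identityʳ (d k j)) ⟨
      Σ₁ W (λ j → d k j * 1ℚ)                     ≤⟨ Σ₁-mono-≤ W (λ j _ _ → *-monoˡ-≤-0≤ (d≥0 k j)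
                                                                      (ℕ→ℚ-mono-≤ (ℕ.m^n>0 2 ⌊log₂ j ⌋))) ⟩
      Ebar k                                      ∎)
      where open ℚ.≤-Reasoning

    ρ-nonNeg : 0ℚ ≤ ρ
    ρ-nonNeg = minFin-greatest λ i → ÷'-nonNeg (ℚ.<⇒≤ (c>0 i)) (Ebar-pos i)

    ρ*Ebar≤c : ∀ k → ρ * Ebar k ≤ c k
    ρ*Ebar≤c k = ℚ.≤-trans (*-monoʳ-≤-0≤ (ℚ.<⇒≤ (Ebar-pos k)) (minFin-≤ _ k))
                           (ℚ.≤-reflexive (÷'-*-cancel (c k) (Ebar-pos k)))

    T-nonNeg : 0ℚ ≤ T
    T-nonNeg = *-nonNeg (*-nonNeg (ℕ→ℚ-nonNeg W) (ℚ.nonNegative⁻¹ half)) ρ-nonNeg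

    linear-≤-dyadic : ∀ v l → ℕ→ℚ v * half * ρ ≤ ρ * ℕ→ℚ (2 ^ ⌊log₂ l ⌋) + ℕ→ℚ (v ∸ l) * half * ρ
    linear-≤-dyadic v l = begin
      ℕ→ℚ v * half * ρ                                  ≤⟨ *-monoʳ-≤-0≤ ρ-nonNeg (*-monoʳ-≤-0≤ (ℚ.nonNegative⁻¹ half) (ℕ→ℚ-mono-≤ v≤)) ⟩
      ℕ→ℚ (2 ℕ.* 2 ^ ⌊log₂ l ⌋ ℕ.+ (v ∸ l)) * half * ρ ≡⟨ cong (λ x → x * half * ρ)
                                                            (trans (ℕ→ℚ-+ (2 ℕ.* 2 ^ ⌊log₂ l ⌋) (v ∸ l)) (cong (_+ ℕ→ℚ (v ∸ l)) (ℕ→ℚ-* 2 (2 ^ ⌊log₂ l ⌋)))) ⟩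
      (ℕ→ℚ 2 * E + r) * half * ρ                        ≡⟨ rearrange (ℕ→ℚ 2) E r half ρ ⟩
      (ℕ→ℚ 2 * half) * (ρ * E) + r * half * ρ           ≡⟨ cong (_+ r * half * ρ) (ℚ.*-identityˡ (ρ * E)) ⟩
      ρ * E + r * half * ρ                              ∎
      where
      open ℚ.≤-Reasoning
      E = ℕ→ℚ (2 ^ ⌊log₂ l ⌋)
      r = ℕ→ℚ (v ∸ l)
      v≤ : v ≤ℕ 2 ℕ.* 2 ^ ⌊log₂ l ⌋ ℕ.+ (v ∸ l)
      v≤ = ℕ.≤-trans (ℕ.m≤n+m∸n v l) (ℕ.+-monoˡ-≤ (v ∸ l) (ℕ.<⇒≤ (n<2^[1+⌊log₂n⌋] l)))
      rearrange : ∀ t E r h p → (t * E + r) * h * p ≡ (t * h) * (p * E) + r * h * p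
      rearrange = solve-∀ ℚ-ring

    OPT-≥-linear : ∀ v → ℕ→ℚ v * half * ρ ≤ OPT v
    OPT-≥-linear = <-rec _ step
      where
      step : ∀ v → (∀ {y} → y <ℕ v → ℕ→ℚ y * half * ρ ≤ OPT y) → ℕ→ℚ v * half * ρ ≤ OPT v
      step zero    _   = ℚ.≤-reflexive (ℚ.*-zeroˡ ρ)
      step (suc u) rec = subst (a ≤_) (sym (OPT-suc u)) (minFin-greatest λ k → begin
        a                                                           ≡⟨ ℚ.*-identityʳ a ⟨
        a * 1ℚ                                                      ≡⟨ cong (a *_) (Σd≡1 k) ⟨
        a * Σ₁ W (d k)                                              ≡⟨ Σ₁-*ˡ W a (d k) ⟨
        Σ₁ W (λ l → a * d k l)                                      ≤⟨ Σ₁-mono-≤ W (λ l _ _ → subst (_≤ d k l * (ρ * E l + R l)) (ℚ.*-comm (d k l) a)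
                                                                          (*-monoˡ-≤-0≤ (d≥0 k l) (linear-≤-dyadic (suc u) l))) ⟩
        Σ₁ W (λ l → d k l * (ρ * E l + R l))                        ≡⟨ Σ₁-cong W (λ l _ _ → ℚ.*-distribˡ-+ (d k l) _ _) ⟩
        Σ₁ W (λ l → d k l * (ρ * E l) + d k l * R l)                ≡⟨ Σ₁-+ W _ _ ⟩
        Σ₁ W (λ l → d k l * (ρ * E l)) + Σ₁ W (λ l → d k l * R l)   ≡⟨ cong (_+ Σ₁ W (λ l → d k l * R l))
                                                                          (trans (Σ₁-cong W (λ l _ _ → swap (d k l) ρ (E l))) (Σ₁-*ˡ W ρ _)) ⟩
        ρ * Ebar k + Σ₁ W (λ l → d k l * R l)                       ≤⟨ ℚ.+-mono-≤ (ρ*Ebar≤c k) (Σ₁-mono-≤ W λ l 1≤l _ →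
                                                                          *-monoˡ-≤-0≤ (d≥0 k l) (rec {suc u ∸ l} (s≤s (ℕ.∸-monoʳ-≤ (suc u) 1≤l)))) ⟩
        c k + Σ₁ W (λ l → d k l * OPT (suc u ∸ l))                  ∎)
        where
        open ℚ.≤-Reasoning
        a = ℕ→ℚ (suc u) * half * ρ
        E : ℕ → ℚ
        E l = ℕ→ℚ (2 ^ ⌊log₂ l ⌋)
        R : ℕ → ℚ
        R l = ℕ→ℚ (suc u ∸ l) * half * ρ
        swap : ∀ x y z → x * (y * z) ≡ y * (x * z)
        swap = solve-∀ ℚ-ring

    T≤OPT : T ≤ OPT W
    T≤OPT = OPT-≥-linear W

  module Rounds (c>0 : ∀ k → 0ℚ < c k) (d≥0 : ∀ k l → 0ℚ ≤ d k l) (Σd≡1 : ∀ k → Σ₁ W (d k) ≡ 1ℚ)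
                (1≤W : 1 ≤ℕ W) (0<ε : 0ℚ < ε) (ε<1 : ε < 1ℚ) (expensive : ∀ k → θ * T ≤ c k) where
    open LowerBound c>0 d≥0 Σd≡1
    open Monotone (λ k → ℚ.<⇒≤ (c>0 k)) d≥0

    tenth : ℚ
    tenth = + 1 / 10

    e μ : ℚ
    e = ε * tenth
    μ = 1ℚ - e

    e-nonNeg : 0ℚ ≤ e
    e-nonNeg = *-nonNeg (ℚ.<⇒≤ 0<ε) (ℚ.nonNegative⁻¹ tenth)

    e≤1 : e ≤ 1ℚ
    e≤1 = ℚ.≤-trans (*-monoʳ-≤-0≤ (ℚ.nonNegative⁻¹ tenth) (ℚ.<⇒≤ ε<1)) (ℚ.≤ᵇ⇒≤ tt)

    μ-nonNeg : 0ℚ ≤ μ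
    μ-nonNeg = p≤q⇒0≤q-p e≤1

    δ-nonNeg : 0ℚ ≤ δ
    δ-nonNeg = ÷'-nonNeg (*-nonNeg (ℚ.<⇒≤ 0<ε) (ℚ.<⇒≤ 0<ε)) (ℕ→ℚ-pos (100 ℕ.* n))

    δ≡e*θ : δ ≡ e * θ
    δ≡e*θ = sym (÷'-unique (ℕ→ℚ-pos (100 ℕ.* n)) (begin
      e * θ * ℕ→ℚ (100 ℕ.* n)                   ≡⟨ cong (λ x → e * θ * x)
                                                     (trans (cong ℕ→ℚ (ℕ.*-assoc 10 10 n)) (ℕ→ℚ-* 10 (10 ℕ.* n))) ⟩
      ε * tenth * θ * (ℕ→ℚ 10 * ℕ→ℚ (10 ℕ.* n))  ≡⟨ regroup ε tenth θ (ℕ→ℚ 10) (ℕ→ℚ (10 ℕ.* n)) ⟩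
      ε * (tenth * ℕ→ℚ 10) * (θ * ℕ→ℚ (10 ℕ.* n)) ≡⟨ cong (λ x → ε * 1ℚ * x) (÷'-*-cancel ε (ℕ→ℚ-pos (10 ℕ.* n))) ⟩
      ε * 1ℚ * ε                                ≡⟨ cong (_* ε) (ℚ.*-identityʳ ε) ⟩
      ε * ε                                     ∎))
      where
      open ≡-Reasoning
      regroup : ∀ a b t x y → a * b * t * (x * y) ≡ a * (b * x) * (t * y)
      regroup = solve-∀ ℚ-ring

    δT≤e*c : ∀ k → δ * T ≤ e * c k
    δT≤e*c k = begin
      δ * T        ≡⟨ cong (_* T) δ≡e*θ ⟩
      e * θ * T    ≡⟨ ℚ.*-assoc e θ T ⟩
      e * (θ * T)  ≤⟨ *-monoˡ-≤-0≤ e-nonNeg (expensive k) ⟩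
      e * c k      ∎
      where open ℚ.≤-Reasoning

    lvl-nonNeg : ∀ j → 0ℚ ≤ lvl j
    lvl-nonNeg j = *-nonNeg (*-nonNeg (ℕ→ℚ-nonNeg j) δ-nonNeg) T-nonNeg

    lvl-suc∸δT : ∀ j → lvl (suc j) - δ * T ≡ lvl j
    lvl-suc∸δT j = trans (cong (λ x → x * δ * T - δ * T) (ℕ→ℚ-suc j)) (peel (ℕ→ℚ j) δ T)
      where
      peel : ∀ a b t → (1ℚ + a) * b * t - b * t ≡ a * b * t
      peel = solve-∀ ℚ-ring

    SettledUpper StaircaseLower : (ℕ → ℕ) → ℕ → Set
    SettledUpper   F r = ∀ w {j} → 1 ≤ℕ w → findJ F w 1 r ≡ just j → OPT w ≤ lvl j
    StaircaseLower F r = ∀ w → 1 ≤ℕ w → w ≤ℕ W → μ * (g F (suc r) w - δ * T) ≤ OPT w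

    settledPart-nonNeg : ∀ φ → 0ℚ ≤ settledPart φ
    settledPart-nonNeg (just j) = lvl-nonNeg j
    settledPart-nonNeg nothing  = ℚ.≤-refl

    feasible⇒OPT≤level : ∀ F r u → SettledUpper F r → suc u ≤ℕ W → feasible F (suc r) (suc u) ≡ true →
                         OPT (suc u) ≤ lvl (suc r)
    feasible⇒OPT≤level F r u settled 1+u≤W feas = affine-fixpoint-≤ {p = p} 0<s (lvl-nonNeg (suc r)) x≤s+px s+pL≤L
      where
      open ℚ.≤-Reasoning
      k = proj₁ (feasible-witness F (suc r) u feas)
      L = lvl (suc r)
      x = OPT (suc u)
      φ : ℕ → Maybe ℕ
      φ j = findJ F j 1 r
      s = insertCost (λ j → settledPart (φ j)) k u
      p = Σ₁ u (λ j → d k (suc u ∸ j) * pendingPart (φ j))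
      0<s : 0ℚ < s
      0<s = ℚ.<-≤-trans (c>0 k) (gap⇒≤ _ (Σ₁-nonNeg u λ j _ _ → *-nonNeg (d≥0 k _) (settledPart-nonNeg (φ j))) refl)
      OPT≤split : ∀ j → 1 ≤ℕ j → j ≤ℕ u → OPT j ≤ settledPart (φ j) + pendingPart (φ j) * x
      OPT≤split j 1≤j j≤u = by-bracket (φ j) refl
        where
        by-bracket : ∀ ψ → φ j ≡ ψ → OPT j ≤ settledPart ψ + pendingPart ψ * x
        by-bracket (just i) φj = ℚ.≤-trans (settled j 1≤j φj) (ℚ.≤-reflexive (sym (p+0*q≡p (lvl i) x)))
        by-bracket nothing  _  = ℚ.≤-trans (OPT-mono-≤ (ℕ.m≤n⇒m≤1+n j≤u)) (ℚ.≤-reflexive (sym (0+1*p≡p x)))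
      x≤s+px : x ≤ s + p * x
      x≤s+px = begin
        x                                                                   ≡⟨ OPT-insert (ℕ.<⇒≤ 1+u≤W) ⟩
        minFin (λ k → insertCost OPT k u)                                   ≤⟨ minFin-≤ _ k ⟩
        insertCost OPT k u                                                  ≤⟨ insertCost-mono-≤ k u OPT≤split ⟩
        insertCost (λ j → settledPart (φ j) + pendingPart (φ j) * x) k u    ≡⟨ insertCost-affine _ _ x k u ⟩
        s + p * x                                                           ∎
      s+pL≤L : s + p * L ≤ L
      s+pL≤L = begin
        s + p * L                                                           ≡⟨ insertCost-affine _ _ L k u ⟨
        insertCost (λ j → settledPart (φ j) + pendingPart (φ j) * L) k u    ≡⟨ insertCost-cong k u (λ j _ _ →
                                                                                 sym (trans (g≡bracketLevel F r j) (bracketLevel-split (suc r) (φ j)))) ⟩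
        insertCost (g F (suc r)) k u                                        ≤⟨ proj₂ (feasible-witness F (suc r) u feas) ⟩
        L                                                                   ∎

    infeasible⇒level≤OPT : ∀ F r u → StaircaseLower F r → suc u ≤ℕ W → feasible F (suc r) (suc u) ≡ false →
                           μ * lvl (suc r) ≤ OPT (suc u)
    infeasible⇒level≤OPT F r u lower 1+u≤W infeas =
      subst (μ * lvl (suc r) ≤_) (sym (OPT-insert u≤W)) (minFin-greatest λ k → begin
        μ * lvl (suc r)                                     ≤⟨ discounted-≤ e-nonNeg e≤1 δT-nonNeg (δT≤e*c k) (mass≤1 k)
                                                                 (ℚ.<⇒≤ (infeasible-all F (suc r) u infeas k)) ⟩
        c k + (μ * S k - μ * (δ * T) * P k)                 ≡⟨ insertCost-discount (g F (suc r)) μ (δ * T) k u ⟨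
        insertCost (λ j → μ * (g F (suc r) j - δ * T)) k u  ≤⟨ insertCost-mono-≤ k u (λ j 1≤j j≤u →
                                                                 lower j 1≤j (ℕ.≤-trans j≤u u≤W)) ⟩
        insertCost OPT k u                                  ∎)
      where
      open ℚ.≤-Reasoning
      u≤W = ℕ.<⇒≤ 1+u≤W
      δT-nonNeg = *-nonNeg δ-nonNeg T-nonNeg
      S P : Fin n → ℚ
      S k = Σ₁ u (λ j → d k (suc u ∸ j) * g F (suc r) j)
      P k = Σ₁ u (λ j → d k (suc u ∸ j))
      mass≤1 : ∀ k → P k ≤ 1ℚ
      mass≤1 k = subst₂ _≤_ (sym (Σ₁-reverse u (d k))) (Σd≡1 k) (Σ₁-≤-extend u≤W λ l _ _ → d≥0 k l)

    record Invariant (F : ℕ → ℕ) (r : ℕ) : Set where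
      field
        lower          : StaircaseLower F r
        settled        : SettledUpper F r
        beyond-last    : ∀ w → 1 ≤ℕ w → findJ F w 1 r ≡ nothing → F r <ℕ w
        target-pending : findJ F W 1 r ≡ nothing

    invariant-initial : Invariant (λ _ → 0) 0
    invariant-initial = record
      { lower          = λ w _ _ → ℚ.≤-trans (ℚ.≤-reflexive vanish) (OPT-nonNeg w)
      ; settled        = λ _ _ ()
      ; beyond-last    = λ _ 1≤w _ → 1≤w
      ; target-pending = refl
      }
      where
      vanish : μ * (lvl 1 - δ * T) ≡ 0ℚ
      vanish = begin
        μ * (1ℚ * δ * T - δ * T)  ≡⟨ cong (λ x → μ * (x * T - δ * T)) (ℚ.*-identityˡ δ) ⟩
        μ * (δ * T - δ * T)       ≡⟨ cong (μ *_) (ℚ.+-inverseʳ (δ * T)) ⟩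
        μ * 0ℚ                    ≡⟨ ℚ.*-zeroʳ μ ⟩
        0ℚ                        ∎
        where open ≡-Reasoning

    OPT≤level-up-to-fNext : ∀ {F r} → SettledUpper F r → ∀ w → 1 ≤ℕ w → w ≤ℕ fNext F (suc r) → OPT w ≤ lvl (suc r)
    OPT≤level-up-to-fNext {F} {r} settled w 1≤w w≤f =
      let u , w≤1+u , 1+u≤W , feas = maxFeas-witness F (suc r) W 1≤w w≤f
      in ℚ.≤-trans (OPT-mono-≤ w≤1+u) (feasible⇒OPT≤level F r u settled 1+u≤W feas)

    invariant-step : ∀ {F r} → Invariant F r → fNext F (suc r) <ℕ W → Invariant (extend F r) (suc r)
    invariant-step {F} {r} inv f<W = record
      { lower          = lower′
      ; settled        = settled′
      ; beyond-last    = beyond-last′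
      ; target-pending = target-pending′ (refine F r W (beyond-last W 1≤W))
      }
      where
      open Invariant inv
      refine-at : ∀ w → 1 ≤ℕ w → Refinement F r w
      refine-at w 1≤w = refine F r w (beyond-last w 1≤w)

      lower′ : StaircaseLower (extend F r) (suc r)
      lower′ zero    ()
      lower′ (suc u) 1≤w 1+u≤W = by-refinement (refine-at (suc u) 1≤w)
        where
        keep : ∀ {a} → g F (suc r) (suc u) ≡ a → g (extend F r) (suc (suc r)) (suc u) ≡ a →
               μ * (g (extend F r) (suc (suc r)) (suc u) - δ * T) ≤ OPT (suc u)
        keep old new = subst (λ z → μ * (z - δ * T) ≤ OPT (suc u)) (trans old (sym new)) (lower (suc u) 1≤w 1+u≤W)
        by-refinement : Refinement F r (suc u) → μ * (g (extend F r) (suc (suc r)) (suc u) - δ * T) ≤ OPT (suc u)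
        by-refinement (kept φ φ′)            = keep (g-settled F r (suc u) φ) (g-settled (extend F r) (suc r) (suc u) φ′)
        by-refinement (newly-settled φ _ φ′) = keep (g-pending F r (suc u) φ) (g-settled (extend F r) (suc r) (suc u) φ′)
        by-refinement (still-pending _ f<w φ′) = subst (λ z → μ * z ≤ OPT (suc u)) level-drop
          (infeasible⇒level≤OPT F r u lower 1+u≤W (maxFeas-maximal F (suc r) W 1+u≤W f<w))
          where
          level-drop : lvl (suc r) ≡ g (extend F r) (suc (suc r)) (suc u) - δ * T
          level-drop = trans (sym (lvl-suc∸δT (suc r))) (cong (_- δ * T) (sym (g-pending (extend F r) (suc r) (suc u) φ′)))

      settled′ : SettledUpper (extend F r) (suc r)
      settled′ w {j} 1≤w φ′ = by-refinement (refine-at w 1≤w)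
        where
        by-refinement : Refinement F r w → OPT w ≤ lvl j
        by-refinement (kept φ φ″) = subst (λ i → OPT w ≤ lvl i) (just-injective (trans (sym φ″) φ′)) (settled w 1≤w φ)
        by-refinement (newly-settled _ w≤f φ″) =
          subst (λ i → OPT w ≤ lvl i) (just-injective (trans (sym φ″) φ′)) (OPT≤level-up-to-fNext settled w 1≤w w≤f)
        by-refinement (still-pending _ _ φ″) = contradiction (trans (sym φ″) φ′) λ ()

      beyond-last′ : ∀ w → 1 ≤ℕ w → findJ (extend F r) w 1 (suc r) ≡ nothing → extend F r (suc r) <ℕ w
      beyond-last′ w 1≤w φ′ = by-refinement (refine-at w 1≤w)
        where
        by-refinement : Refinement F r w → extend F r (suc r) <ℕ w
        by-refinement (kept _ φ″)            = contradiction (trans (sym φ″) φ′) λ ()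
        by-refinement (newly-settled _ _ φ″) = contradiction (trans (sym φ″) φ′) λ ()
        by-refinement (still-pending _ f<w _) = subst (_<ℕ w) (sym (extend-new F r)) f<w

      target-pending′ : Refinement F r W → findJ (extend F r) W 1 (suc r) ≡ nothing
      target-pending′ (kept φ _)              = contradiction (trans (sym φ) target-pending) λ ()
      target-pending′ (newly-settled _ W≤f _) = contradiction f<W (ℕ.≤⇒≯ W≤f)
      target-pending′ (still-pending _ _ φ′)  = φ′

    Bounds : ℚ → Set
    Bounds V = (1ℚ - δ) * μ * V ≤ OPT W × OPT W ≤ V

    stop-bounds : ∀ {F r} → Invariant F r → W ≤ℕ fNext F (suc r) → Bounds (lvl (suc r))
    stop-bounds {F} {r} inv W≤f = lower-end , upper-end
      where
      open Invariant inv
      open ℚ.≤-Reasoning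
      V = lvl (suc r)
      upper-end : OPT W ≤ V
      upper-end = OPT≤level-up-to-fNext settled W 1≤W W≤f
      lower-end : (1ℚ - δ) * μ * V ≤ OPT W
      lower-end = begin
        (1ℚ - δ) * μ * V              ≤⟨ gap⇒≤ (μ * (δ * (V - T)))
                                           (*-nonNeg μ-nonNeg (*-nonNeg δ-nonNeg (p≤q⇒0≤q-p (ℚ.≤-trans T≤OPT upper-end))))
                                           (shift δ μ V T) ⟩
        μ * (V - δ * T)               ≡⟨ cong (λ z → μ * (z - δ * T)) (g-pending F r W target-pending) ⟨
        μ * (g F (suc r) W - δ * T)   ≤⟨ lower W 1≤W ℕ.≤-refl ⟩
        OPT W                         ∎
        where
        shift : ∀ a b v t → (1ℚ - a) * b * v + b * (a * (v - t)) ≡ b * (v - a * t)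
        shift = solve-∀ ℚ-ring

    loop-sound : ∀ fuel {F r V} → Invariant F r → loop F (suc r) fuel ≡ just V → Bounds V
    loop-sound zero                   _   ()
    loop-sound (suc fuel) {F} {r} {V} inv = by-test (W ℕ.≤ᵇ fNext F (suc r)) (ℕ.≤ᵇ-reflects-≤ W (fNext F (suc r)))
      where
      by-test : ∀ b → Reflects (W ≤ℕ fNext F (suc r)) b →
                (if b then just (lvl (suc r)) else loop (extend F r) (suc (suc r)) fuel) ≡ just V → Bounds V
      by-test true  (ofʸ W≤f) done = subst Bounds (just-injective done) (stop-bounds inv W≤f)
      by-test false (ofⁿ W≰f) more = loop-sound fuel (invariant-step inv (ℕ.≰⇒> W≰f)) more

theorem1 : (m W : ℕ) → 1 ≤ℕ W → (ε : ℚ) → 0ℚ < ε → ε < 1ℚ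
    → (c : Fin (suc m) → ℚ) → (∀ i → 0ℚ < c i)
    → (d : Fin (suc m) → ℕ → ℚ)
    → (∀ i k → 0ℚ ≤ d i k)
    → (∀ i k → (k ≡ 0 ⊎ W <ℕ k) → d i k ≡ 0ℚ)
    → (∀ i → Σ₁ W (d i) ≡ 1ℚ)
    → (∀ i → Knapsack.θ m W c d ε * Knapsack.T m W c d ε ≤ c i)
    → (V : ℚ) → Knapsack.DP m W c d ε ≡ just V
    → ((1ℚ - Knapsack.δ m W c d ε) * (1ℚ - ε * (+ 1 / 10)) * V ≤ Knapsack.OPT m W c d ε W)
      × (Knapsack.OPT m W c d ε W ≤ V)
theorem1 m W 1≤W ε 0<ε ε<1 c c>0 d d≥0 _ Σd≡1 expensive V DP≡V = loop-sound rounds invariant-initial DP≡V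
  where
  open Knapsack m W c d ε using (rounds)
  open DPAnalysis m W c d ε
  open Rounds c>0 d≥0 Σd≡1 1≤W 0<ε ε<1 expensive
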